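{- The sequence $\left((n!!)^{1/n}\right)_{n\ge 2}$ is strictly increasing; that is, for every integer $n\ge 2$, $(n!!)^{1/n}>((n-1)!!)^{1/(n-1)}$.
   Context: For a positive integer $m$, the double factorial $m!!$ is the product of all positive integers $\le m$ having the same parity as $m$, i.e. $m!!=m(m-2)(m-4)\cdots$, ending in $1$ if $m$ is odd and in $2$ if $m$ is even. -}

module Defs where

open import Data.Nat using (ℕ; zero; suc; _*_)

_!! : ℕ → ℕ
zero !! = 1
suc zero !! = 1
suc (suc m) !! = suc (suc m) * (m !!)

{-# OPTIONS --safe #-}

-- Write a n for n !!. Since a (n + 2) = (n + 2) a n, the inequality
-- a n ^ (n + 1) < a (n + 1) ^ n at n yields the one at n + 2 as soon as
--   (n + 2) ^ (n + 3) a n ² ≤ (n + 3) ^ (n + 2) a (n + 1) ².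
-- This splits into (n + 2) a n ² ≤ 2 a (n + 1) ², proved by its own
-- induction in steps of two using (n + 2) (n + 4) < (n + 3) ², and into
-- 2 p ^ p ≤ (p + 1) ^ p, i.e. (1 + 1/p) ^ p ≥ 2, an instance of Bernoulli's
-- inequality.
module Submission where

open import Defs
open import Data.Nat using (ℕ; zero; suc; _+_; _*_; _∸_; _^_; _<_; _≤_; z≤n; s≤s; NonZero)
open import Data.Nat.Properties
open import Data.Nat.Tactic.RingSolver using (solve-∀)
open import Algebra.Properties.CommutativeSemigroup *-commutativeSemigroup
  using (interchange; x∙yz≈y∙xz)
open import Relation.Binary.PropositionalEquality using (_≡_; refl; cong; module ≡-Reasoning)

^-distribʳ-* : ∀ m n o → (m * n) ^ o ≡ m ^ o * n ^ o
^-distribʳ-* m n zero    = refl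
^-distribʳ-* m n (suc o) = begin
  m * n * (m * n) ^ o      ≡⟨ cong (m * n *_) (^-distribʳ-* m n o) ⟩
  m * n * (m ^ o * n ^ o)  ≡⟨ interchange m n (m ^ o) (n ^ o) ⟩
  m * m ^ o * (n * n ^ o)  ∎
  where open ≡-Reasoning

_!!≢0 : ∀ n → NonZero (n !!)
zero        !!≢0 = _
suc zero    !!≢0 = _
suc (suc n) !!≢0 = m*n≢0 (suc (suc n)) (n !!) {{_}} {{n !!≢0}}

n^k*[n+k]≤n*[1+n]^k : ∀ n k → n ^ k * (n + k) ≤ n * suc n ^ k
n^k*[n+k]≤n*[1+n]^k n zero rewrite +-identityʳ n = ≤-reflexive (*-comm 1 n)
n^k*[n+k]≤n*[1+n]^k n (suc k) = begin
  n * n ^ k * (n + suc k)              ≤⟨ m≤m+n _ (n ^ k * k) ⟩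
  n * n ^ k * (n + suc k) + n ^ k * k  ≡⟨ factor n k (n ^ k) ⟩
  suc n * (n ^ k * (n + k))            ≤⟨ *-monoʳ-≤ (suc n) (n^k*[n+k]≤n*[1+n]^k n k) ⟩
  suc n * (n * suc n ^ k)              ≡⟨ x∙yz≈y∙xz (suc n) n (suc n ^ k) ⟩
  n * (suc n * suc n ^ k)              ∎
  where
  open ≤-Reasoning
  factor : ∀ n k x → n * x * (n + suc k) + x * k ≡ suc n * (x * (n + k))
  factor = solve-∀

2*n^n≤[1+n]^n : ∀ n .{{_ : NonZero n}} → 2 * n ^ n ≤ suc n ^ n
2*n^n≤[1+n]^n n = *-cancelˡ-≤ n (begin
  n * (2 * n ^ n)  ≡⟨ regroup n (n ^ n) ⟩
  n ^ n * (n + n)  ≤⟨ n^k*[n+k]≤n*[1+n]^k n n ⟩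
  n * suc n ^ n    ∎)
  where
  open ≤-Reasoning
  regroup : ∀ n x → n * (2 * x) ≡ x * (n + n)
  regroup = solve-∀

[2+n]*n!!²≤2*[1+n]!!² : ∀ n → (2 + n) * (n !! * n !!) ≤ 2 * (suc n !! * suc n !!)
[2+n]*n!!²≤2*[1+n]!!² zero          = ≤-refl
[2+n]*n!!²≤2*[1+n]!!² (suc zero)    = s≤s (s≤s (s≤s z≤n))
[2+n]*n!!²≤2*[1+n]!!² (suc (suc n)) = begin
  (4 + n) * ((2 + n) * a * ((2 + n) * a))  ≡⟨ regroup n a ⟩
  (4 + n) * (2 + n) * ((2 + n) * (a * a))  ≤⟨ *-mono-≤ [4+n]*[2+n]≤[3+n]*[3+n] ([2+n]*n!!²≤2*[1+n]!!² n) ⟩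
  (3 + n) * (3 + n) * (2 * (b * b))        ≡⟨ regroup′ n b ⟩
  2 * ((3 + n) * b * ((3 + n) * b))        ∎
  where
  open ≤-Reasoning
  a = n !!
  b = suc n !!
  [4+n]*[2+n]≤[3+n]*[3+n] : (4 + n) * (2 + n) ≤ (3 + n) * (3 + n)
  [4+n]*[2+n]≤[3+n]*[3+n] = ≤-trans (n≤1+n _) (≤-reflexive (completeSquare n))
    where
    completeSquare : ∀ n → 1 + (4 + n) * (2 + n) ≡ (3 + n) * (3 + n)
    completeSquare = solve-∀
  regroup : ∀ n a → (4 + n) * ((2 + n) * a * ((2 + n) * a)) ≡ (4 + n) * (2 + n) * ((2 + n) * (a * a))
  regroup = solve-∀
  regroup′ : ∀ n b → (3 + n) * (3 + n) * (2 * (b * b)) ≡ 2 * ((3 + n) * b * ((3 + n) * b))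
  regroup′ = solve-∀

[2+n]^[3+n]*n!!²≤[3+n]^[2+n]*[1+n]!!² : ∀ n →
  (2 + n) ^ (3 + n) * (n !! * n !!) ≤ (3 + n) ^ (2 + n) * (suc n !! * suc n !!)
[2+n]^[3+n]*n!!²≤[3+n]^[2+n]*[1+n]!!² n = *-cancelˡ-≤ 2 (begin
  2 * (p ^ suc p * a²)      ≡⟨ regroup p (p ^ p) a² ⟩
  2 * p ^ p * (p * a²)      ≤⟨ *-mono-≤ (2*n^n≤[1+n]^n p) ([2+n]*n!!²≤2*[1+n]!!² n) ⟩
  suc p ^ p * (2 * b²)      ≡⟨ x∙yz≈y∙xz (suc p ^ p) 2 b² ⟩
  2 * (suc p ^ p * b²)      ∎)
  where
  open ≤-Reasoning
  p = 2 + n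
  a² = n !! * n !!
  b² = suc n !! * suc n !!
  regroup : ∀ p x y → 2 * (p * x * y) ≡ 2 * x * (p * y)
  regroup = solve-∀

n!!^[1+n]<[1+n]!!^n : ∀ n .{{_ : NonZero n}} → n !! ^ suc n < suc n !! ^ n
n!!^[1+n]<[1+n]!!^n 1 = ≤-refl
n!!^[1+n]<[1+n]!!^n 2 = ≤-refl
n!!^[1+n]<[1+n]!!^n (suc (suc m@(suc _))) = begin-strict
  (p * a) ^ suc p              ≡⟨ ^-distribʳ-* p a (suc p) ⟩
  p ^ suc p * a ^ suc p        ≡⟨ regroup (p ^ suc p) a (a ^ suc m) ⟩
  p ^ suc p * a² * a ^ suc m   <⟨ *-monoʳ-< (p ^ suc p * a²) {{nonZero}} (n!!^[1+n]<[1+n]!!^n m) ⟩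
  p ^ suc p * a² * b ^ m       ≤⟨ *-monoˡ-≤ (b ^ m) ([2+n]^[3+n]*n!!²≤[3+n]^[2+n]*[1+n]!!² m) ⟩
  suc p ^ p * b² * b ^ m       ≡⟨ regroup (suc p ^ p) b (b ^ m) ⟨
  suc p ^ p * b ^ p            ≡⟨ ^-distribʳ-* (suc p) b p ⟨
  (suc p * b) ^ p              ∎
  where
  open ≤-Reasoning
  p = 2 + m
  a = m !!
  b = suc m !!
  a² = a * a
  b² = b * b
  nonZero : NonZero (p ^ suc p * a²)
  nonZero = m*n≢0 _ _ {{m^n≢0 p (suc p)}} {{m*n≢0 a a {{m !!≢0}} {{m !!≢0}}}}
  regroup : ∀ c x y → c * (x * (x * y)) ≡ c * (x * x) * y
  regroup = solve-∀

lemma2p1 : (n : ℕ) → 2 ≤ n →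
    ((n ∸ 1) !!) ^ n < (n !!) ^ (n ∸ 1)
lemma2p1 (suc (suc n)) (s≤s (s≤s z≤n)) = n!!^[1+n]<[1+n]!!^n (suc n)
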